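{- Let $G=(V,E)$ be a finite simple graph of class two and let $C\subseteq V$ be a minimum vertex cover of $G$. Then for every nonempty independent set $A\subseteq C$ we have $|N_{V-C}(A)|>2|A|$.
   Context: All graphs are finite and simple. For $X\subseteq V$, $N(X)$ is the union of neighborhoods of vertices of $X$ and $N_S(X)=N(X)\cap S$. $\beta(G)$ is the size of a minimum vertex cover. Alcuin problem: the vertices of $G$ are items initially on the left bank of a river; a man with a boat of capacity $b$ (a positive integer) must carry them all to the right bank so that no two adjacent vertices are ever left together on a bank. Formally, a feasible schedule for capacity $b$ is a sequence of triples $(L_k,B_k,R_k)$, $k=1,\dots,s$, $s$ odd, such that: each triple is a partition of $V$; $L_k$ and $R_k$ are independent sets; $|B_k|\le b$; $L_1\cup B_1=V$; $B_s\cup R_s=V$; for even $k$, $L_k=L_{k-1}$ and $B_k\cup R_k=B_{k-1}\cup R_{k-1}$; for odd $k\ge 3$, $R_k=R_{k-1}$ and $B_k\cup L_k=B_{k-1}\cup L_{k-1}$. The Alcuin number $c(G)$ is the least positive integer $b$ for which a feasible schedule exists. One always has $\beta(G)\le c(G)\le \beta(G)+1$; $G$ is of class one if $c(G)=\beta(G)$ and of class two if $c(G)=\beta(G)+1$. -}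

module Defs where

open import Data.Bool using (Bool; true; false; _∧_; _∨_; not)
open import Data.Nat using (ℕ; zero; suc; _+_; _*_; _≤_; _<_)
open import Data.Fin using (Fin)
open import Data.Vec using (lookup; tabulate)
open import Data.Fin.Subset using (Subset; _∈_; _∉_; _∪_; _∩_; ⊥; ⊤; ∣_∣)
open import Data.Product using (_×_; Σ; ∃; _,_)
open import Data.Sum using (_⊎_)
open import Relation.Binary.PropositionalEquality using (_≡_)
open import Relation.Nullary using (¬_)

record Graph (n : ℕ) : Set where
  field
    adj   : Fin n → Fin n → Bool
    sym   : ∀ u v → adj u v ≡ adj v u
    irrefl : ∀ v → adj v v ≡ false

module _ {n : ℕ} (G : Graph n) where
  open Graph G

  Adjacent : Fin n → Fin n → Set
  Adjacent u v = adj u v ≡ true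

  Independent : Subset n → Set
  Independent S = ∀ u v → u ∈ S → v ∈ S → ¬ Adjacent u v

  VertexCover : Subset n → Set
  VertexCover C = ∀ u v → Adjacent u v → u ∈ C ⊎ v ∈ C

  MinimumVertexCover : Subset n → Set
  MinimumVertexCover C = VertexCover C × (∀ D → VertexCover D → ∣ C ∣ ≤ ∣ D ∣)

  IsVertexCoverNumber : ℕ → Set
  IsVertexCoverNumber β = Σ (Subset n) λ C → MinimumVertexCover C × ∣ C ∣ ≡ β

  Partition : Subset n → Subset n → Subset n → Set
  Partition L B R =
    (L ∪ B) ∪ R ≡ ⊤ × L ∩ B ≡ ⊥ × L ∩ R ≡ ⊥ × B ∩ R ≡ ⊥

  -- A feasible schedule for capacity b: s = 2m+1 triples (L_k,B_k,R_k),
  -- k = 1..s, given as ℕ-indexed families (values outside 1..s irrelevant).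
  record Schedule (b : ℕ) : Set where
    field
      m : ℕ
      L B R : ℕ → Subset n
      partition : ∀ k → 1 ≤ k → k ≤ 2 * m + 1 → Partition (L k) (B k) (R k)
      indepL    : ∀ k → 1 ≤ k → k ≤ 2 * m + 1 → Independent (L k)
      indepR    : ∀ k → 1 ≤ k → k ≤ 2 * m + 1 → Independent (R k)
      capacity  : ∀ k → 1 ≤ k → k ≤ 2 * m + 1 → ∣ B k ∣ ≤ b
      start     : L 1 ∪ B 1 ≡ ⊤
      finish    : B (2 * m + 1) ∪ R (2 * m + 1) ≡ ⊤
      evenL     : ∀ j → 1 ≤ j → 2 * j ≤ 2 * m + 1 → L (2 * j) ≡ L (2 * j Data.Nat.∸ 1)
      evenBR    : ∀ j → 1 ≤ j → 2 * j ≤ 2 * m + 1 →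
                  B (2 * j) ∪ R (2 * j) ≡ B (2 * j Data.Nat.∸ 1) ∪ R (2 * j Data.Nat.∸ 1)
      oddR      : ∀ j → 1 ≤ j → 2 * j + 1 ≤ 2 * m + 1 → R (2 * j + 1) ≡ R (2 * j)
      oddBL     : ∀ j → 1 ≤ j → 2 * j + 1 ≤ 2 * m + 1 →
                  B (2 * j + 1) ∪ L (2 * j + 1) ≡ B (2 * j) ∪ L (2 * j)

  IsAlcuinNumber : ℕ → Set
  IsAlcuinNumber c = 1 ≤ c × Schedule c × (∀ b → 1 ≤ b → Schedule b → c ≤ b)

  ClassTwo : Set
  ClassTwo = ∃ λ β → IsVertexCoverNumber β × IsAlcuinNumber (suc β)

  anyFin : ∀ {k} → (Fin k → Bool) → Bool
  anyFin {zero}  f = false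
  anyFin {suc k} f = f Data.Fin.zero ∨ anyFin (λ i → f (Data.Fin.suc i))


  NbhdOutside : Subset n → Subset n → Subset n
  NbhdOutside C A =
    tabulate (λ v → not (lookup C v) ∧ anyFin (λ a → lookup A a ∧ adj a v))

module Submission where

-- If |N_{V−C}(A)| ≤ 2|A|, split N_{V−C}(A) into N₁, N₂ of size at most |A| each.  Then a boat
-- of capacity |C| = β(G) suffices, contradicting class two.  The vertices of C − A ride in the
-- boat throughout and the remaining |A| seats carry, in turn: A (leaving the independent set
-- V − C behind); N₁, after A is dropped on the right; A back to the left, after N₁ is dropped;
-- N₂; then every other vertex of V − C alone (these have no neighbour in A, so they may share
-- a bank with it); and finally A.  Adjacent vertices never share a bank: one of them lies in
-- the cover C, hence in A, and A is independent, has no neighbours among those other vertices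
-- of V − C, and never shares a bank with N₁ or N₂.

open import Defs
open import Data.Bool using (Bool; true; false; _∧_; _∨_; not)
open import Data.Bool.Properties using (∨-inverseˡ; ∨-zeroʳ)
open import Data.Fin using (Fin; zero; suc; toℕ)
open import Data.Fin.Properties using (toℕ<n)
open import Data.Fin.Subset
  using (Subset; _∈_; _∉_; _⊆_; _∪_; _∩_; _─_; ⁅_⁆; ⊤; ⊥; ∣_∣; Nonempty)
open import Data.Fin.Subset.Properties
  using (_∈?_; p⊆q⇒∣p∣≤∣q∣; ∣p∣≤∣x∷p∣; s⊆s; drop-∷-⊆; ⊥⊆; x∈⁅x⁆; x∈⁅y⁆⇒x≡y; ∣⁅x⁆∣≡1;
         x∈p∪q⁻; x∈p∪q⁺; x∈p∧x∉q⇒x∈p─q; ∉⊥)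
open import Data.Nat using (ℕ; zero; suc; _+_; _*_; _∸_; _≤_; _<_; z≤n; s≤s; _<?_)
open import Data.Nat.Properties
  using (≤-refl; ≤-trans; ≤-reflexive; ≤-antisym; +-suc; +-comm; +-identityʳ; *-suc; +-monoʳ-≤;
         ≮⇒≥; n≮n; module ≤-Reasoning)
open import Data.Product using (Σ; ∃₂; _×_; _,_; proj₁; proj₂)
open import Data.Sum using (_⊎_; inj₁; inj₂; [_,_]′)
open import Data.Vec using ([]; _∷_; here; tabulate; lookup; zipWith; replicate)
open import Data.Vec.Properties using (lookup∘tabulate; tabulate-cong; []=⇒lookup; lookup⇒[]=)
open import Data.Empty using (⊥-elim)
open import Function using (_∘_)
open import Relation.Nullary using (yes; no)
open import Relation.Nullary.Decidable using (decidable-stable)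
open import Relation.Binary.PropositionalEquality
  using (_≡_; _≢_; refl; sym; trans; cong; cong₂; subst; subst₂)

zipWith-tabulate : ∀ {n} {A B C : Set} (_⊕_ : A → B → C) (f : Fin n → A) (g : Fin n → B) →
                   zipWith _⊕_ (tabulate f) (tabulate g) ≡ tabulate (λ i → f i ⊕ g i)
zipWith-tabulate {zero}  _⊕_ f g = refl
zipWith-tabulate {suc n} _⊕_ f g =
  cong (f zero ⊕ g zero ∷_) (zipWith-tabulate _⊕_ (f ∘ suc) (g ∘ suc))

tabulate-constant : ∀ {n} {A : Set} {f : Fin n → A} {x : A} →
                    (∀ i → f i ≡ x) → tabulate f ≡ replicate n x
tabulate-constant {zero}  _ = refl
tabulate-constant {suc n} h = cong₂ _∷_ (h zero) (tabulate-constant (h ∘ suc))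

∉⇒lookup≡false : ∀ {n} {x : Fin n} {p : Subset n} → x ∉ p → lookup p x ≡ false
∉⇒lookup≡false {x = x} {p} x∉p with lookup p x in eq
... | true  = ⊥-elim (x∉p (lookup⇒[]= x p eq))
... | false = refl

∣p∪q∣≤∣p∣+∣q∣ : ∀ {n} (p q : Subset n) → ∣ p ∪ q ∣ ≤ ∣ p ∣ + ∣ q ∣
∣p∪q∣≤∣p∣+∣q∣ []          []          = z≤n
∣p∪q∣≤∣p∣+∣q∣ (true ∷ p)  (s ∷ q)     =
  s≤s (≤-trans (∣p∪q∣≤∣p∣+∣q∣ p q) (+-monoʳ-≤ ∣ p ∣ (∣p∣≤∣x∷p∣ s q)))
∣p∪q∣≤∣p∣+∣q∣ (false ∷ p) (true ∷ q)  =
  ≤-trans (s≤s (∣p∪q∣≤∣p∣+∣q∣ p q)) (≤-reflexive (sym (+-suc ∣ p ∣ ∣ q ∣)))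
∣p∪q∣≤∣p∣+∣q∣ (false ∷ p) (false ∷ q) = ∣p∪q∣≤∣p∣+∣q∣ p q

∣p─q∣+∣q∣≡∣p∣ : ∀ {n} {p q : Subset n} → q ⊆ p → ∣ p ─ q ∣ + ∣ q ∣ ≡ ∣ p ∣
∣p─q∣+∣q∣≡∣p∣ {p = []}        {[]}       _   = refl
∣p─q∣+∣q∣≡∣p∣ {p = true ∷ p}  {true ∷ q} q⊆p =
  trans (+-suc ∣ p ─ q ∣ ∣ q ∣) (cong suc (∣p─q∣+∣q∣≡∣p∣ (drop-∷-⊆ q⊆p)))
∣p─q∣+∣q∣≡∣p∣ {p = false ∷ p} {true ∷ q} q⊆p with q⊆p here
... | ()
∣p─q∣+∣q∣≡∣p∣ {p = true ∷ p}  {false ∷ q} q⊆p = cong suc (∣p─q∣+∣q∣≡∣p∣ (drop-∷-⊆ q⊆p))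
∣p─q∣+∣q∣≡∣p∣ {p = false ∷ p} {false ∷ q} q⊆p = ∣p─q∣+∣q∣≡∣p∣ (drop-∷-⊆ q⊆p)

⊆-split : ∀ {n} (p : Subset n) a b → ∣ p ∣ ≤ a + b →
          ∃₂ λ q r → p ⊆ q ∪ r × ∣ q ∣ ≤ a × ∣ r ∣ ≤ b
⊆-split []          a       b       _          = [] , [] , (λ ()) , z≤n , z≤n
⊆-split (false ∷ p) a       b       ∣p∣≤a+b    with ⊆-split p a b ∣p∣≤a+b
... | q , r , p⊆q∪r , ∣q∣≤a , ∣r∣≤b = false ∷ q , false ∷ r , s⊆s p⊆q∪r , ∣q∣≤a , ∣r∣≤b
⊆-split (true ∷ p)  (suc a) b       (s≤s ∣p∣≤) with ⊆-split p a b ∣p∣≤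
... | q , r , p⊆q∪r , ∣q∣≤a , ∣r∣≤b = true ∷ q , false ∷ r , s⊆s p⊆q∪r , s≤s ∣q∣≤a , ∣r∣≤b
⊆-split (true ∷ p)  zero    (suc b) (s≤s ∣p∣≤) with ⊆-split p zero b ∣p∣≤
... | q , r , p⊆q∪r , ∣q∣≤a , ∣r∣≤b = false ∷ q , true ∷ r , s⊆s p⊆q∪r , ∣q∣≤a , s≤s ∣r∣≤b
⊆-split (true ∷ p)  zero    zero    ()

nonempty⇒∣p∣>0 : ∀ {n} {p : Subset n} → Nonempty p → 0 < ∣ p ∣
nonempty⇒∣p∣>0 {p = p} (x , x∈p) = subst (_≤ ∣ p ∣) (∣⁅x⁆∣≡1 x)
  (p⊆q⇒∣p∣≤∣q∣ (λ y∈⁅x⁆ → subst (_∈ p) (sym (x∈⁅y⁆⇒x≡y x y∈⁅x⁆)) x∈p))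

data Place : Set where
  left boat right : Place

_is_ : Place → Place → Bool
left  is left  = true
boat  is boat  = true
right is right = true
_     is _     = false

is⇒≡ : ∀ {p q} → p is q ≡ true → p ≡ q
is⇒≡ {left}  {left}  _ = refl
is⇒≡ {boat}  {boat}  _ = refl
is⇒≡ {right} {right} _ = refl
is⇒≡ {left}  {boat}  ()
is⇒≡ {left}  {right} ()
is⇒≡ {boat}  {left}  ()
is⇒≡ {boat}  {right} ()
is⇒≡ {right} {left}  ()
is⇒≡ {right} {boat}  ()

is≡false⇒≢ : ∀ {p q} → p is q ≡ false → p ≢ q
is≡false⇒≢ {left}  () refl
is≡false⇒≢ {boat}  () refl
is≡false⇒≢ {right} () refl

at : ∀ {n} → Place → (Fin n → Place) → Subset n
at p f = tabulate (λ v → f v is p)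

∈-at : ∀ {n} {p} {f : Fin n → Place} {v} → v ∈ at p f → f v ≡ p
∈-at {p = p} {f} {v} v∈ =
  is⇒≡ (trans (sym (lookup∘tabulate (λ w → f w is p) v)) ([]=⇒lookup v∈))

off : ∀ {n} → Place → (Fin n → Place) → Subset n
off p f = tabulate (λ v → not (f v is p))

off≡⊤ : ∀ {n} {p} {f : Fin n → Place} → (∀ v → f v is p ≡ false) → off p f ≡ ⊤
off≡⊤ h = tabulate-constant (cong not ∘ h)

at-∪ : ∀ {n} {p q r} (f : Fin n → Place) → (∀ s → (s is p) ∨ (s is q) ≡ not (s is r)) →
       at p f ∪ at q f ≡ off r f
at-∪ f h = trans (zipWith-tabulate _∨_ _ _) (tabulate-cong (h ∘ f))

left∪boat≡off-right : ∀ {n} (f : Fin n → Place) → at left f ∪ at boat f ≡ off right f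
left∪boat≡off-right f = at-∪ f λ { left → refl ; boat → refl ; right → refl }

boat∪right≡off-left : ∀ {n} (f : Fin n → Place) → at boat f ∪ at right f ≡ off left f
boat∪right≡off-left f = at-∪ f λ { left → refl ; boat → refl ; right → refl }

boat∪left≡off-right : ∀ {n} (f : Fin n → Place) → at boat f ∪ at left f ≡ off right f
boat∪left≡off-right f = at-∪ f λ { left → refl ; boat → refl ; right → refl }

at-disjoint : ∀ {n} {p q} (f : Fin n → Place) → (∀ s → (s is p) ∧ (s is q) ≡ false) →
              at p f ∩ at q f ≡ ⊥
at-disjoint f h = trans (zipWith-tabulate _∧_ _ _) (tabulate-constant (h ∘ f))

-- forth i is the (2i+1)-th step of a schedule, when the boat is loaded at the left bank;
-- back i is the (2i+2)-th step, when it is loaded at the right bank.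
data Crossing : Set where
  forth back : ℕ → Crossing

next : Crossing → Crossing
next (forth i) = back i
next (back i)  = forth (suc i)

-- Steps are counted from 1; crossing 0 is never used.
crossing : ℕ → Crossing
crossing zero          = forth 0
crossing (suc zero)    = forth 0
crossing (suc (suc k)) = next (crossing (suc k))

crossing-1+2* : ∀ j → crossing (suc (2 * j)) ≡ forth j
crossing-1+2* zero    = refl
crossing-1+2* (suc j) =
  trans (cong (crossing ∘ suc) (*-suc 2 j)) (cong (next ∘ next) (crossing-1+2* j))

crossing-odd : ∀ j → crossing (2 * j + 1) ≡ forth j
crossing-odd j = trans (cong crossing (+-comm (2 * j) 1)) (crossing-1+2* j)

crossing-even : ∀ i → crossing (2 * suc i) ≡ back i
crossing-even i = trans (cong crossing (*-suc 2 i)) (cong next (crossing-1+2* i))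

crossing-even∸1 : ∀ i → crossing (2 * suc i ∸ 1) ≡ forth i
crossing-even∸1 i = trans (cong (λ k → crossing (k ∸ 1)) (*-suc 2 i)) (crossing-1+2* i)

module _ {n : ℕ} (G : Graph n) where

  record Plan (b : ℕ) : Set where
    field
      rounds      : ℕ
      place       : Crossing → Fin n → Place
      starts-left : ∀ v → place (forth 0) v is right ≡ false
      ends-right  : ∀ v → place (forth rounds) v is left ≡ false
      stays-left  : ∀ i v → place (back i) v is left ≡ place (forth i) v is left
      stays-right : ∀ i v → place (forth (suc i)) v is right ≡ place (back i) v is right
      banks-safe  : ∀ c u v → Adjacent G u v → place c u ≡ place c v → place c u ≡ boat
      boat-fits   : ∀ c → ∣ at boat (place c) ∣ ≤ b

  at-partition : (f : Fin n → Place) → Partition G (at left f) (at boat f) (at right f)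
  at-partition f =
      trans (cong (_∪ at right f) (left∪boat≡off-right f))
            (trans (zipWith-tabulate _∨_ _ _) (tabulate-constant (λ v → ∨-inverseˡ (f v is right))))
    , at-disjoint f (λ { left → refl ; boat → refl ; right → refl })
    , at-disjoint f (λ { left → refl ; boat → refl ; right → refl })
    , at-disjoint f (λ { left → refl ; boat → refl ; right → refl })

  plan⇒schedule : ∀ {b} → Plan b → Schedule G b
  plan⇒schedule P = record
    { m         = rounds
    ; L         = side left ∘ crossing
    ; B         = side boat ∘ crossing
    ; R         = side right ∘ crossing
    ; partition = λ k _ _ → at-partition (place (crossing k))
    ; indepL    = λ k _ _ → bank-independent (crossing k) (λ ())
    ; indepR    = λ k _ _ → bank-independent (crossing k) (λ ())
    ; capacity  = λ k _ _ → boat-fits (crossing k)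
    ; start     = trans (left∪boat≡off-right _) (off≡⊤ starts-left)
    ; finish    = subst (λ c → offLeft c ≡ ⊤) (sym (crossing-odd rounds))
                        (trans (boat∪right≡off-left _) (off≡⊤ ends-right))
    ; evenL     = λ { (suc i) _ _ →
                    along (crossing-even i) (crossing-even∸1 i) (side left) (left-stays i) }
    ; evenBR    = λ { (suc i) _ _ →
                    along (crossing-even i) (crossing-even∸1 i) offLeft (offLeft-stays i) }
    ; oddR      = λ { (suc i) _ _ →
                    along (crossing-odd (suc i)) (crossing-even i) (side right) (right-stays i) }
    ; oddBL     = λ { (suc i) _ _ →
                    along (crossing-odd (suc i)) (crossing-even i) offRight (offRight-stays i) }
    }
    where
    open Plan P

    side : Place → Crossing → Subset n
    side p c = at p (place c)

    offLeft offRight : Crossing → Subset n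
    offLeft  c = side boat c ∪ side right c
    offRight c = side boat c ∪ side left c

    along : ∀ {x y c d} → x ≡ c → y ≡ d → (F : Crossing → Subset n) → F c ≡ F d → F x ≡ F y
    along x≡c y≡d F = subst₂ (λ c d → F c ≡ F d) (sym x≡c) (sym y≡d)

    bank-independent : ∀ c {p} → p ≢ boat → Independent G (side p c)
    bank-independent c p≢boat u v u∈ v∈ uv =
      p≢boat (trans (sym (∈-at u∈)) (banks-safe c u v uv (trans (∈-at u∈) (sym (∈-at v∈)))))

    left-stays : ∀ i → side left (back i) ≡ side left (forth i)
    left-stays i = tabulate-cong (stays-left i)

    right-stays : ∀ i → side right (forth (suc i)) ≡ side right (back i)
    right-stays i = tabulate-cong (stays-right i)

    offLeft-stays : ∀ i → offLeft (back i) ≡ offLeft (forth i)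
    offLeft-stays i = trans (boat∪right≡off-left _)
      (trans (tabulate-cong (cong not ∘ stays-left i)) (sym (boat∪right≡off-left _)))

    offRight-stays : ∀ i → offRight (forth (suc i)) ≡ offRight (back i)
    offRight-stays i = trans (boat∪left≡off-right _)
      (trans (tabulate-cong (cong not ∘ stays-right i)) (sym (boat∪left≡off-right _)))

-- far x is a vertex of V − C without neighbours in A; it crosses alone at forth (3 + toℕ x).
data Kind (n : ℕ) : Set where
  inA restOfC near₁ near₂ : Kind n
  far : Fin n → Kind n

waitThenBoard : ℕ → ℕ → Place
waitThenBoard zero    _       = boat
waitThenBoard (suc n) zero    = left
waitThenBoard (suc n) (suc j) = waitThenBoard n j

ferryForth ferryBack : ℕ → ℕ → Place
ferryForth zero    zero    = boat
ferryForth zero    (suc _) = right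
ferryForth (suc _) zero    = left
ferryForth (suc x) (suc j) = ferryForth x j
ferryBack  zero    _       = right
ferryBack  (suc _) zero    = left
ferryBack  (suc x) (suc j) = ferryBack x j

route : ∀ {n} → Kind n → Crossing → Place
route restOfC _ = boat
route inA (forth 0) = boat
route inA (back 0)  = right
route inA (forth 1) = right
route inA (back 1)  = boat
route inA (forth 2) = left
route inA (back 2)  = left
route {n} inA (forth (suc (suc (suc j)))) = waitThenBoard n j
route {n} inA (back (suc (suc (suc j))))  = waitThenBoard n j
route near₁ (forth 0) = left
route near₁ (back 0)  = left
route near₁ (forth 1) = boat
route near₁ _         = right
route near₂ (forth 0) = left
route near₂ (back 0)  = left
route near₂ (forth 1) = left
route near₂ (back 1)  = left
route near₂ (forth 2) = boat
route near₂ _         = right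
route (far x) (forth (suc (suc (suc j)))) = ferryForth (toℕ x) j
route (far x) (back (suc (suc (suc j))))  = ferryBack (toℕ x) j
route (far x) _ = left

waitThenBoard-never-right : ∀ n j → waitThenBoard n j is right ≡ false
waitThenBoard-never-right zero    _       = refl
waitThenBoard-never-right (suc n) zero    = refl
waitThenBoard-never-right (suc n) (suc j) = waitThenBoard-never-right n j

waitThenBoard-n-n : ∀ n → waitThenBoard n n ≡ boat
waitThenBoard-n-n zero    = refl
waitThenBoard-n-n (suc n) = waitThenBoard-n-n n

ferryForth-0-not-right : ∀ x → ferryForth x 0 is right ≡ false
ferryForth-0-not-right zero    = refl
ferryForth-0-not-right (suc x) = refl

ferryForth-< : ∀ {x j} → x < j → ferryForth x j ≡ right
ferryForth-< {zero}  {suc j} _         = refl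
ferryForth-< {suc x} {suc j} (s≤s x<j) = ferryForth-< x<j

ferryBack≢boat : ∀ x j → ferryBack x j ≢ boat
ferryBack≢boat zero    _       ()
ferryBack≢boat (suc x) zero    ()
ferryBack≢boat (suc x) (suc j) = ferryBack≢boat x j

ferry-stays-left : ∀ x j → ferryBack x j is left ≡ ferryForth x j is left
ferry-stays-left zero    zero    = refl
ferry-stays-left zero    (suc j) = refl
ferry-stays-left (suc x) zero    = refl
ferry-stays-left (suc x) (suc j) = ferry-stays-left x j

ferry-stays-right : ∀ x j → ferryForth x (suc j) is right ≡ ferryBack x j is right
ferry-stays-right zero    j       = refl
ferry-stays-right (suc x) zero    = ferryForth-0-not-right x
ferry-stays-right (suc x) (suc j) = ferry-stays-right x j

route-starts : ∀ {n} (κ : Kind n) → route κ (forth 0) is right ≡ false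
route-starts inA     = refl
route-starts restOfC = refl
route-starts near₁   = refl
route-starts near₂   = refl
route-starts (far x) = refl

route-ends : ∀ {n} (κ : Kind n) → route κ (forth (3 + n)) is left ≡ false
route-ends {n} inA = cong (_is left) (waitThenBoard-n-n n)
route-ends restOfC = refl
route-ends near₁   = refl
route-ends near₂   = refl
route-ends (far x) = cong (_is left) (ferryForth-< (toℕ<n x))

route-stays-left : ∀ {n} (κ : Kind n) i → route κ (back i) is left ≡ route κ (forth i) is left
route-stays-left inA 0 = refl
route-stays-left inA 1 = refl
route-stays-left inA 2 = refl
route-stays-left inA (suc (suc (suc j))) = refl
route-stays-left restOfC i = refl
route-stays-left near₁ 0 = refl
route-stays-left near₁ 1 = refl
route-stays-left near₁ (suc (suc i)) = refl
route-stays-left near₂ 0 = refl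
route-stays-left near₂ 1 = refl
route-stays-left near₂ 2 = refl
route-stays-left near₂ (suc (suc (suc j))) = refl
route-stays-left (far x) 0 = refl
route-stays-left (far x) 1 = refl
route-stays-left (far x) 2 = refl
route-stays-left (far x) (suc (suc (suc j))) = ferry-stays-left (toℕ x) j

route-stays-right : ∀ {n} (κ : Kind n) i →
                    route κ (forth (suc i)) is right ≡ route κ (back i) is right
route-stays-right inA 0 = refl
route-stays-right inA 1 = refl
route-stays-right {n} inA 2 = waitThenBoard-never-right n 0
route-stays-right {n} inA (suc (suc (suc j))) =
  trans (waitThenBoard-never-right n (suc j)) (sym (waitThenBoard-never-right n j))
route-stays-right restOfC i = refl
route-stays-right near₁ 0 = refl
route-stays-right near₁ (suc i) = refl
route-stays-right near₂ 0 = refl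
route-stays-right near₂ 1 = refl
route-stays-right near₂ (suc (suc i)) = refl
route-stays-right (far x) 0 = refl
route-stays-right (far x) 1 = refl
route-stays-right (far x) 2 = ferryForth-0-not-right (toℕ x)
route-stays-right (far x) (suc (suc (suc j))) = ferry-stays-right (toℕ x) j

inA-apart-near₁ : ∀ {n} c → route {n} inA c ≡ route {n} near₁ c → route {n} inA c ≡ boat
inA-apart-near₁ (forth 0) _ = refl
inA-apart-near₁ (back 1)  _ = refl
inA-apart-near₁ (back 0)  ()
inA-apart-near₁ (forth 1) ()
inA-apart-near₁ (forth 2) ()
inA-apart-near₁ (back 2)  ()
inA-apart-near₁ {n} (forth (suc (suc (suc j)))) same =
  ⊥-elim (is≡false⇒≢ (waitThenBoard-never-right n j) same)
inA-apart-near₁ {n} (back (suc (suc (suc j)))) same =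
  ⊥-elim (is≡false⇒≢ (waitThenBoard-never-right n j) same)

inA-apart-near₂ : ∀ {n} c → route {n} inA c ≡ route {n} near₂ c → route {n} inA c ≡ boat
inA-apart-near₂ (forth 0) _ = refl
inA-apart-near₂ (back 1)  _ = refl
inA-apart-near₂ (back 0)  ()
inA-apart-near₂ (forth 1) ()
inA-apart-near₂ (forth 2) ()
inA-apart-near₂ (back 2)  ()
inA-apart-near₂ {n} (forth (suc (suc (suc j)))) same =
  ⊥-elim (is≡false⇒≢ (waitThenBoard-never-right n j) same)
inA-apart-near₂ {n} (back (suc (suc (suc j)))) same =
  ⊥-elim (is≡false⇒≢ (waitThenBoard-never-right n j) same)

liftKind : ∀ {n} → Kind n → Kind (suc n)
liftKind inA     = inA
liftKind restOfC = restOfC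
liftKind near₁   = near₁
liftKind near₂   = near₂
liftKind (far x) = far (suc x)

ferryCrew : (n : ℕ) → ℕ → Kind n
ferryCrew zero    _       = inA
ferryCrew (suc n) zero    = far zero
ferryCrew (suc n) (suc j) = liftKind (ferryCrew n j)

crew : ∀ {n} → Crossing → Kind n
crew (forth 1) = near₁
crew (forth 2) = near₂
crew {n} (forth (suc (suc (suc j)))) = ferryCrew n j
crew _ = inA

ferryCrew-far : ∀ {n} (x : Fin n) j → ferryForth (toℕ x) j ≡ boat → ferryCrew n j ≡ far x
ferryCrew-far zero    zero    _     = refl
ferryCrew-far (suc x) (suc j) board = cong liftKind (ferryCrew-far x j board)
ferryCrew-far zero    (suc j) ()
ferryCrew-far (suc x) zero    ()

ferryCrew-inA : ∀ n j → waitThenBoard n j ≡ boat → ferryCrew n j ≡ inA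
ferryCrew-inA zero    _       _     = refl
ferryCrew-inA (suc n) (suc j) board = cong liftKind (ferryCrew-inA n j board)
ferryCrew-inA (suc n) zero    ()

boarding : ∀ {n} c (κ : Kind n) → route κ c ≡ boat → κ ≡ restOfC ⊎ κ ≡ crew c
boarding c restOfC _ = inj₁ refl
boarding (back i) inA _ = inj₂ refl
boarding (forth 0) inA _ = inj₂ refl
boarding (forth 1) inA ()
boarding (forth 2) inA ()
boarding {n} (forth (suc (suc (suc j)))) inA board = inj₂ (sym (ferryCrew-inA n j board))
boarding (forth 1) near₁ _ = inj₂ refl
boarding (forth 0) near₁ ()
boarding (forth (suc (suc i))) near₁ ()
boarding (back 0) near₁ ()
boarding (back (suc i)) near₁ ()
boarding (forth 2) near₂ _ = inj₂ refl
boarding (forth 0) near₂ ()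
boarding (forth 1) near₂ ()
boarding (forth (suc (suc (suc j)))) near₂ ()
boarding (back 0) near₂ ()
boarding (back 1) near₂ ()
boarding (back (suc (suc i))) near₂ ()
boarding (forth (suc (suc (suc j)))) (far x) board = inj₂ (sym (ferryCrew-far x j board))
boarding (back (suc (suc (suc j)))) (far x) board = ⊥-elim (ferryBack≢boat (toℕ x) j board)
boarding (forth 0) (far x) ()
boarding (forth 1) (far x) ()
boarding (forth 2) (far x) ()
boarding (back 0) (far x) ()
boarding (back 1) (far x) ()
boarding (back 2) (far x) ()

anyFin-true : ∀ {m} (G : Graph m) {k} (f : Fin k → Bool) i → f i ≡ true → anyFin G f ≡ true
anyFin-true G f zero    fi = cong (_∨ anyFin G (f ∘ suc)) fi
anyFin-true G f (suc i) fi =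
  trans (cong (f zero ∨_) (anyFin-true G (f ∘ suc) i fi)) (∨-zeroʳ (f zero))

module CoverFerry {n : ℕ} (G : Graph n) (C A N₁ N₂ : Subset n)
  (C-cover : VertexCover G C) (A⊆C : A ⊆ C) (A-independent : Independent G A)
  (A-nonempty : Nonempty A) (N⊆N₁∪N₂ : NbhdOutside G C A ⊆ N₁ ∪ N₂)
  (∣N₁∣≤∣A∣ : ∣ N₁ ∣ ≤ ∣ A ∣) (∣N₂∣≤∣A∣ : ∣ N₂ ∣ ≤ ∣ A ∣) where

  N : Subset n
  N = NbhdOutside G C A

  outside-neighbour∈N : ∀ {u v} → u ∈ A → Adjacent G u v → v ∉ C → v ∈ N
  outside-neighbour∈N {u} {v} u∈A uv v∉C =
    lookup⇒[]= v N (trans (lookup∘tabulate _ v)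
      (cong₂ _∧_ (cong not (∉⇒lookup≡false v∉C))
                 (anyFin-true G (λ a → lookup A a ∧ Graph.adj G a v) u
                              (cong₂ _∧_ ([]=⇒lookup u∈A) uv))))

  data View (v : Fin n) : Kind n → Set where
    inA     : v ∈ A → View v inA
    restOfC : v ∈ C ─ A → View v restOfC
    near₁   : v ∉ C → v ∈ N₁ → View v near₁
    near₂   : v ∉ C → v ∈ N₂ → View v near₂
    far     : v ∉ C → v ∉ N → View v (far v)

  classify : ∀ v → Σ (Kind n) (View v)
  classify v with v ∈? A | v ∈? C | v ∈? N₁ | v ∈? N₂
  ... | yes v∈A | _       | _        | _        = inA , inA v∈A
  ... | no v∉A  | yes v∈C | _        | _        = restOfC , restOfC (x∈p∧x∉q⇒x∈p─q v∈C v∉A)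
  ... | no _    | no v∉C  | yes v∈N₁ | _        = near₁ , near₁ v∉C v∈N₁
  ... | no _    | no v∉C  | no _     | yes v∈N₂ = near₂ , near₂ v∉C v∈N₂
  ... | no _    | no v∉C  | no v∉N₁  | no v∉N₂  =
    far v , far v∉C (λ v∈N → [ v∉N₁ , v∉N₂ ]′ (x∈p∪q⁻ N₁ N₂ (N⊆N₁∪N₂ v∈N)))

  kind : Fin n → Kind n
  kind v = proj₁ (classify v)

  view : ∀ v → View v (kind v)
  view v = proj₂ (classify v)

  place : Crossing → Fin n → Place
  place c v = route (kind v) c

  cover-endpoint-boards : ∀ c {u v κ μ} → u ∈ C → Adjacent G u v → View u κ → View v μ →
                          route κ c ≡ route μ c → route κ c ≡ boat
  cover-endpoint-boards c u∈C _  (near₁ u∉C _) _ _ = ⊥-elim (u∉C u∈C)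
  cover-endpoint-boards c u∈C _  (near₂ u∉C _) _ _ = ⊥-elim (u∉C u∈C)
  cover-endpoint-boards c u∈C _  (far u∉C _)   _ _ = ⊥-elim (u∉C u∈C)
  cover-endpoint-boards c _   _  (restOfC _)   _ _ = refl
  cover-endpoint-boards c _   uv (inA u∈A) (inA v∈A)   _    =
    ⊥-elim (A-independent _ _ u∈A v∈A uv)
  cover-endpoint-boards c _   _  (inA _)   (restOfC _) same = same
  cover-endpoint-boards c _   _  (inA _)   (near₁ _ _) same = inA-apart-near₁ c same
  cover-endpoint-boards c _   _  (inA _)   (near₂ _ _) same = inA-apart-near₂ c same
  cover-endpoint-boards c _   uv (inA u∈A) (far v∉C v∉N) _  =
    ⊥-elim (v∉N (outside-neighbour∈N u∈A uv v∉C))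

  banks-safe : ∀ c u v → Adjacent G u v → place c u ≡ place c v → place c u ≡ boat
  banks-safe c u v uv same with C-cover u v uv
  ... | inj₁ u∈C = cover-endpoint-boards c u∈C uv (view u) (view v) same
  ... | inj₂ v∈C = trans same
    (cover-endpoint-boards c v∈C (trans (Graph.sym G v u) uv) (view v) (view u) (sym same))

  group : Kind n → Subset n
  group inA     = A
  group restOfC = ⊥
  group near₁   = N₁
  group near₂   = N₂
  group (far x) = ⁅ x ⁆

  ∣group∣≤∣A∣ : ∀ κ → ∣ group κ ∣ ≤ ∣ A ∣
  ∣group∣≤∣A∣ inA     = ≤-refl
  ∣group∣≤∣A∣ restOfC = p⊆q⇒∣p∣≤∣q∣ (⊥⊆ {p = A})
  ∣group∣≤∣A∣ near₁   = ∣N₁∣≤∣A∣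
  ∣group∣≤∣A∣ near₂   = ∣N₂∣≤∣A∣
  ∣group∣≤∣A∣ (far x) = ≤-trans (≤-reflexive (∣⁅x⁆∣≡1 x)) (nonempty⇒∣p∣>0 A-nonempty)

  in-group : ∀ {v κ} → View v κ → v ∈ C ─ A ⊎ v ∈ group κ
  in-group (inA v∈A)      = inj₂ v∈A
  in-group (restOfC v∈D)  = inj₁ v∈D
  in-group (near₁ _ v∈N₁) = inj₂ v∈N₁
  in-group (near₂ _ v∈N₂) = inj₂ v∈N₂
  in-group {v} (far _ _)  = inj₂ (x∈⁅x⁆ v)

  boat⊆ : ∀ c → at boat (place c) ⊆ (C ─ A) ∪ group (crew c)
  boat⊆ c {v} v∈boat with boarding c (kind v) (∈-at v∈boat) | in-group (view v)
  ... | _          | inj₁ v∈D       = x∈p∪q⁺ (inj₁ v∈D)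
  ... | inj₂ isCrew | inj₂ v∈group = x∈p∪q⁺ (inj₂ (subst (λ κ → v ∈ group κ) isCrew v∈group))
  ... | inj₁ isRest | inj₂ v∈group = ⊥-elim (∉⊥ (subst (λ κ → v ∈ group κ) isRest v∈group))

  boat-fits : ∀ c → ∣ at boat (place c) ∣ ≤ ∣ C ∣
  boat-fits c = begin
    ∣ at boat (place c) ∣             ≤⟨ p⊆q⇒∣p∣≤∣q∣ (boat⊆ c) ⟩
    ∣ (C ─ A) ∪ group (crew c) ∣     ≤⟨ ∣p∪q∣≤∣p∣+∣q∣ (C ─ A) (group (crew c)) ⟩
    ∣ C ─ A ∣ + ∣ group (crew c) ∣   ≤⟨ +-monoʳ-≤ ∣ C ─ A ∣ (∣group∣≤∣A∣ (crew c)) ⟩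
    ∣ C ─ A ∣ + ∣ A ∣                ≡⟨ ∣p─q∣+∣q∣≡∣p∣ A⊆C ⟩
    ∣ C ∣                            ∎
    where open ≤-Reasoning

  plan : Plan G ∣ C ∣
  plan = record
    { rounds      = 3 + n
    ; place       = place
    ; starts-left = route-starts ∘ kind
    ; ends-right  = route-ends ∘ kind
    ; stays-left  = λ i v → route-stays-left (kind v) i
    ; stays-right = λ i v → route-stays-right (kind v) i
    ; banks-safe  = banks-safe
    ; boat-fits   = boat-fits
    }

small-neighbourhood⇒schedule : ∀ {n} (G : Graph n) (C A : Subset n) →
  VertexCover G C → A ⊆ C → Independent G A → Nonempty A →
  ∣ NbhdOutside G C A ∣ ≤ 2 * ∣ A ∣ → Schedule G ∣ C ∣
small-neighbourhood⇒schedule G C A C-cover A⊆C A-independent A-nonempty ∣N∣≤2∣A∣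
  with ⊆-split (NbhdOutside G C A) ∣ A ∣ ∣ A ∣
         (subst (λ m → ∣ NbhdOutside G C A ∣ ≤ ∣ A ∣ + m) (+-identityʳ ∣ A ∣) ∣N∣≤2∣A∣)
... | N₁ , N₂ , N⊆N₁∪N₂ , ∣N₁∣≤∣A∣ , ∣N₂∣≤∣A∣ =
  plan⇒schedule G (CoverFerry.plan G C A N₁ N₂ C-cover A⊆C A-independent A-nonempty
                                   N⊆N₁∪N₂ ∣N₁∣≤∣A∣ ∣N₂∣≤∣A∣)

minimum-covers-same-size : ∀ {n} (G : Graph n) {C D : Subset n} →
  MinimumVertexCover G C → MinimumVertexCover G D → ∣ C ∣ ≡ ∣ D ∣
minimum-covers-same-size G (C-cover , C-min) (D-cover , D-min) =
  ≤-antisym (C-min _ D-cover) (D-min _ C-cover)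

theorem2p4 : ∀ {n : ℕ} (G : Graph n) → ClassTwo G →
    (C : Subset n) → MinimumVertexCover G C →
    (A : Subset n) → Nonempty A → Independent G A → A ⊆ C →
    2 * ∣ A ∣ < ∣ NbhdOutside G C A ∣
theorem2p4 G (β , (C′ , C′-minimum , ∣C′∣≡β) , _ , _ , alcuin-least)
           C C-minimum A A-nonempty A-independent A⊆C =
  decidable-stable (2 * ∣ A ∣ <? ∣ NbhdOutside G C A ∣) λ ¬large →
    let schedule = small-neighbourhood⇒schedule G C A (proj₁ C-minimum) A⊆C A-independent
                     A-nonempty (≮⇒≥ ¬large)
        1≤∣C∣ = ≤-trans (nonempty⇒∣p∣>0 A-nonempty) (p⊆q⇒∣p∣≤∣q∣ A⊆C)
        ∣C∣≡β = trans (minimum-covers-same-size G C-minimum C′-minimum) ∣C′∣≡β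
    in n≮n β (subst (suc β ≤_) ∣C∣≡β (alcuin-least ∣ C ∣ 1≤∣C∣ schedule))
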